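{- Let $\sigma$ be a chip configuration on $K_n$ with $a(\sigma)<1$, and let $t_0=\min\{t\ge0: U^t\sigma=U^{t'}\sigma\text{ for some }t'>t\}$ be its transient length. Then $U^t\sigma$ is confined for all $t\ge t_0$.
   Context: Parallel chip-firing on $K_n$: $\sigma:[n]\to\mathbb{Z}_{\ge0}$, $r(\sigma)=\#\{v:\sigma(v)\ge n\}$, $U\sigma(v)=\sigma(v)+r(\sigma)$ if $\sigma(v)\le n-1$, $U\sigma(v)=\sigma(v)-n+r(\sigma)$ if $\sigma(v)\ge n$. Activity $a(\sigma)=\lim_t\frac{1}{nt}\sum_{s=0}^{t-1}r(U^s\sigma)$. A configuration $\tau$ is confined if $\tau(v)\le 2n-1$ for all $v$ and $\max_v\tau(v)-\min_v\tau(v)\le n-1$. -}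

module Defs where

open import Data.Nat using (ℕ; zero; suc; _+_; _*_; _∸_; _≤_; _<_; _≤ᵇ_; NonZero)
open import Data.Nat.Properties using (m*n≢0)
open import Data.Bool using (if_then_else_)
open import Data.Fin using (Fin)
open import Data.Vec using (Vec; lookup; map; count)
open import Data.Integer using (+_)
open import Data.Rational as ℚ using (ℚ)
open import Data.Product using (Σ; ∃; _×_)
open import Relation.Binary.PropositionalEquality using (_≡_)
open import Relation.Nullary using (¬_)
open import Relation.Nullary.Decidable using (yes; no)
import Data.Nat as N

Config : ℕ → Set
Config n = Vec ℕ n

r : (n : ℕ) → Config n → ℕ
r n σ = count (λ x → n N.≤? x) σ

U : (n : ℕ) → Config n → Config n
U n σ = map (λ x → if n ≤ᵇ x then x ∸ n + r n σ else x + r n σ) σ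

Uiter : (n : ℕ) → ℕ → Config n → Config n
Uiter n zero σ = σ
Uiter n (suc t) σ = U n (Uiter n t σ)

firings : (n : ℕ) → Config n → ℕ → ℕ
firings n σ zero = 0
firings n σ (suc t) = firings n σ t + r n (Uiter n t σ)

-- the average (1/(n t)) Σ_{s=0}^{t-1} r(U^s σ), for t = suc k ≥ 1
average : (n : ℕ) .{{_ : NonZero n}} → Config n → ℕ → ℚ
average n σ k = (+ firings n σ (suc k)) ℚ./ (n * suc k)
  where instance _ = m*n≢0 n (suc k)

HasActivity : (n : ℕ) .{{_ : NonZero n}} → Config n → ℚ → Set
HasActivity n σ a =
  ∀ (ε : ℚ) → ℚ.0ℚ ℚ.< ε →
    ∃ λ N → ∀ k → N ≤ k → ℚ.∣ average n σ k ℚ.- a ∣ ℚ.< ε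

Recurs : (n : ℕ) → Config n → ℕ → Set
Recurs n σ t = ∃ λ t' → t < t' × Uiter n t σ ≡ Uiter n t' σ

IsTransientLength : (n : ℕ) → Config n → ℕ → Set
IsTransientLength n σ t0 = Recurs n σ t0 × (∀ t → t < t0 → ¬ Recurs n σ t)

Confined : (n : ℕ) → Config n → Set
Confined n τ =
  (∀ (v : Fin n) → lookup τ v ≤ 2 * n ∸ 1) ×
  (∀ (u v : Fin n) → lookup τ u ∸ lookup τ v ≤ n ∸ 1)

module Submission where

-- A vertex that fires at every step from some time T on loses n chips per step and gains
-- r chips, so the total number of firings grows like n t and the activity is at least 1;
-- hence when a(σ) < 1 no vertex fires forever. Let t ≥ t₀, so that the orbit is periodic
-- through τ = U^t σ. If τ had τ u ≥ τ v + n, then u would fire forever: the relation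
-- τ u < τ v + n, once true, is preserved by U, and holds as soon as u stalls, while the
-- orbit returns to τ. So max τ − min τ ≤ n − 1. Then a vertex with at least 2n chips
-- forces every vertex to hold at least n, making τ a fixed point at which it fires forever.

open import Data.Bool using (true; false; T; if_then_else_)
open import Data.Bool.Properties using (if-float)
open import Data.Empty using (⊥-elim)
open import Data.Fin as Fin using (Fin)
open import Data.Integer as ℤ using (ℤ; +_; -[1+_]; +≤+; +<+; -≤+)
import Data.Integer.Properties as ℤP
open import Data.Nat
  using (ℕ; zero; suc; _+_; _*_; _∸_; _≤_; _<_; _≤ᵇ_; _≤?_; _<?_; NonZero; z≤n; s≤s⁻¹)
open import Data.Nat.Properties
open import Algebra.Properties.CommutativeSemigroup +-commutativeSemigroup
  using (xy∙z≈xz∙y; xy∙z≈y∙xz)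
open import Data.Nat.Tactic.RingSolver using (solve-∀)
open import Data.Product using (∃; _×_; _,_)
open import Data.Rational as ℚ using (ℚ; 1ℚ; mkℚ; ↥_; ↧_; ↧ₙ_)
import Data.Rational.Properties as ℚP
import Data.Rational.Unnormalised as ℚᵘ
import Data.Rational.Unnormalised.Properties as ℚᵘP
open import Data.Unit using (tt)
open import Data.Vec using (Vec; []; _∷_; lookup; count; tabulate)
open import Data.Vec.Properties using (lookup-map; tabulate∘lookup; tabulate-cong)
open import Relation.Binary.PropositionalEquality
open import Relation.Nullary using (¬_; yes; no; contradiction)
open import Relation.Unary using (Pred; Decidable)
open import Defs

fireOut : ℕ → ℕ → ℕ
fireOut n x = if n ≤ᵇ x then x ∸ n else x

lookup-U : ∀ n (σ : Config n) v → lookup (U n σ) v ≡ fireOut n (lookup σ v) + r n σ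
lookup-U n σ v = trans (lookup-map v _ σ) (sym (if-float (_+ r n σ) (n ≤ᵇ lookup σ v)))

fireOut-≥ : ∀ {n x} → n ≤ x → fireOut n x ≡ x ∸ n
fireOut-≥ {n} {x} n≤x with n ≤ᵇ x in eq
... | true  = refl
... | false = contradiction (subst T eq (≤⇒≤ᵇ n≤x)) λ ()

fireOut-< : ∀ {n x} → x < n → fireOut n x ≡ x
fireOut-< {n} {x} x<n with n ≤ᵇ x in eq
... | false = refl
... | true  = contradiction (≤ᵇ⇒≤ n x (subst T (sym eq) tt)) (<⇒≱ x<n)

≤-fireOut+n : ∀ n y → y ≤ fireOut n y + n
≤-fireOut+n n y with n ≤? y
... | yes n≤y = ≤-reflexive (sym (trans (cong (_+ n) (fireOut-≥ n≤y)) (m∸n+n≡m n≤y)))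
... | no n≰y  = subst (λ z → y ≤ z + n) (sym (fireOut-< (≰⇒> n≰y))) (m≤m+n y n)

fireOut-gap : ∀ n {x y} → x < y + n → fireOut n x < fireOut n y + n
fireOut-gap n {x} {y} x<y+n with n ≤? x
... | yes n≤x = begin-strict
  fireOut n x      ≡⟨ fireOut-≥ n≤x ⟩
  x ∸ n            <⟨ subst (x ∸ n <_) (m+n∸n≡m y n) (∸-monoˡ-< x<y+n n≤x) ⟩
  y                ≤⟨ ≤-fireOut+n n y ⟩
  fireOut n y + n  ∎
  where open ≤-Reasoning
... | no n≰x = begin-strict
  fireOut n x      ≡⟨ fireOut-< (≰⇒> n≰x) ⟩
  x                <⟨ ≰⇒> n≰x ⟩
  n                ≤⟨ m≤n+m n (fireOut n y) ⟩
  fireOut n y + n  ∎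
  where open ≤-Reasoning

Uiter-+ : ∀ n j s (σ : Config n) → Uiter n (j + s) σ ≡ Uiter n j (Uiter n s σ)
Uiter-+ n zero    s σ = refl
Uiter-+ n (suc j) s σ = cong (U n) (Uiter-+ n j s σ)

U-gap : ∀ n (τ : Config n) u v → lookup τ u < lookup τ v + n →
        lookup (U n τ) u < lookup (U n τ) v + n
U-gap n τ u v gap = begin-strict
  lookup (U n τ) u                    ≡⟨ lookup-U n τ u ⟩
  fireOut n (lookup τ u) + r n τ      <⟨ +-monoˡ-< (r n τ) (fireOut-gap n gap) ⟩
  fireOut n (lookup τ v) + n + r n τ  ≡⟨ xy∙z≈xz∙y _ n (r n τ) ⟩
  fireOut n (lookup τ v) + r n τ + n  ≡⟨ cong (_+ n) (lookup-U n τ v) ⟨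
  lookup (U n τ) v + n                ∎
  where open ≤-Reasoning

Uiter-gap : ∀ n j (τ : Config n) u v → lookup τ u < lookup τ v + n →
            lookup (Uiter n j τ) u < lookup (Uiter n j τ) v + n
Uiter-gap n zero    τ u v gap = gap
Uiter-gap n (suc j) τ u v gap = U-gap n (Uiter n j τ) u v (Uiter-gap n j τ u v gap)

count-all : ∀ {a p} {A : Set a} {P : Pred A p} (P? : Decidable P) {k} (xs : Vec A k) →
            (∀ i → P (lookup xs i)) → count P? xs ≡ k
count-all P? []       _   = refl
count-all P? (x ∷ xs) all with P? x
... | yes _  = cong suc (count-all P? xs (λ i → all (Fin.suc i)))
... | no ¬px = contradiction (all Fin.zero) ¬px

r-all : ∀ n (σ : Config n) → (∀ v → n ≤ lookup σ v) → r n σ ≡ n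
r-all n σ = count-all (n ≤?_) σ

U-stationary : ∀ n (τ : Config n) → (∀ v → n ≤ lookup τ v) → U n τ ≡ τ
U-stationary n τ all = begin
  U n τ                     ≡⟨ tabulate∘lookup (U n τ) ⟨
  tabulate (lookup (U n τ)) ≡⟨ tabulate-cong stays ⟩
  tabulate (lookup τ)       ≡⟨ tabulate∘lookup τ ⟩
  τ                         ∎
  where
  open ≡-Reasoning
  stays : ∀ v → lookup (U n τ) v ≡ lookup τ v
  stays v = begin
    lookup (U n τ) v               ≡⟨ lookup-U n τ v ⟩
    fireOut n (lookup τ v) + r n τ ≡⟨ cong₂ _+_ (fireOut-≥ (all v)) (r-all n τ all) ⟩
    lookup τ v ∸ n + n             ≡⟨ m∸n+n≡m (all v) ⟩
    lookup τ v                     ∎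

Uiter-stationary : ∀ n (τ : Config n) → U n τ ≡ τ → ∀ j → Uiter n j τ ≡ τ
Uiter-stationary n τ fixed zero    = refl
Uiter-stationary n τ fixed (suc j) = trans (cong (U n) (Uiter-stationary n τ fixed j)) fixed

fire-balance : ∀ n (τ : Config n) u → n ≤ lookup τ u →
               lookup (U n τ) u + n ≡ lookup τ u + r n τ
fire-balance n τ u n≤x = begin
  lookup (U n τ) u + n                ≡⟨ cong (_+ n) (lookup-U n τ u) ⟩
  fireOut n (lookup τ u) + r n τ + n  ≡⟨ xy∙z≈xz∙y _ (r n τ) n ⟩
  fireOut n (lookup τ u) + n + r n τ  ≡⟨ cong (λ z → z + n + r n τ) (fireOut-≥ n≤x) ⟩
  lookup τ u ∸ n + n + r n τ          ≡⟨ cong (_+ r n τ) (m∸n+n≡m n≤x) ⟩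
  lookup τ u + r n τ                  ∎
  where open ≡-Reasoning

FiresFrom : ∀ n → Config n → Fin n → ℕ → Set
FiresFrom n σ u T = ∀ s → T ≤ s → n ≤ lookup (Uiter n s σ) u

-- u pays n chips and collects r chips at every step, and firings counts every r.
chips-spent-≤-firings : ∀ n (σ : Config n) u T → FiresFrom n σ u T → ∀ k →
  n * k + lookup (Uiter n (k + T) σ) u ≤ lookup (Uiter n T σ) u + firings n σ (k + T)
chips-spent-≤-firings n σ u T fires zero =
  ≤-trans (≤-reflexive (cong (_+ C) (*-zeroʳ n))) (m≤m+n C (firings n σ T))
  where
  C : ℕ
  C = lookup (Uiter n T σ) u
chips-spent-≤-firings n σ u T fires (suc k) = begin
  n * suc k + lookup (U n τ) u    ≡⟨ rearrange n k (lookup (U n τ) u) ⟩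
  n * k + (lookup (U n τ) u + n)  ≡⟨ cong (λ z → n * k + z) (fire-balance n τ u (fires (k + T) T≤k+T)) ⟩
  n * k + (lookup τ u + r n τ)    ≡⟨ +-assoc (n * k) (lookup τ u) (r n τ) ⟨
  n * k + lookup τ u + r n τ      ≤⟨ +-monoˡ-≤ (r n τ) (chips-spent-≤-firings n σ u T fires k) ⟩
  C + firings n σ (k + T) + r n τ ≡⟨ +-assoc C (firings n σ (k + T)) (r n τ) ⟩
  C + firings n σ (suc k + T)     ∎
  where
  open ≤-Reasoning
  C : ℕ
  C = lookup (Uiter n T σ) u
  τ : Config n
  τ = Uiter n (k + T) σ
  T≤k+T : T ≤ k + T
  T≤k+T = m≤n+m T k
  rearrange : ∀ n k x → n * suc k + x ≡ n * k + (x + n)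
  rearrange = solve-∀

firings-linear : ∀ n (σ : Config n) u T → FiresFrom n σ u T → ∀ k →
  n * (k + T) ≤ firings n σ (k + T) + (lookup (Uiter n T σ) u + n * T)
firings-linear n σ u T fires k = begin
  n * (k + T)                       ≡⟨ *-distribˡ-+ n k T ⟩
  n * k + n * T                     ≤⟨ +-monoˡ-≤ (n * T) spent ⟩
  C + firings n σ (k + T) + n * T   ≡⟨ xy∙z≈y∙xz C _ (n * T) ⟩
  firings n σ (k + T) + (C + n * T) ∎
  where
  open ≤-Reasoning
  C : ℕ
  C = lookup (Uiter n T σ) u
  spent : n * k ≤ C + firings n σ (k + T)
  spent = ≤-trans (m≤m+n (n * k) _) (chips-spent-≤-firings n σ u T fires k)

recurrence-period : ∀ n (σ : Config n) t0 → Recurs n σ t0 →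
                    ∃ λ p → Uiter n (suc p + t0) σ ≡ Uiter n t0 σ
recurrence-period n σ t0 (t' , t0<t' , recurs) with m≤n⇒∃[o]m+o≡n t0<t'
... | p , refl = p , trans (cong (λ s → Uiter n (suc s) σ) (+-comm p t0)) (sym recurs)

Uiter-period-shift : ∀ n (σ : Config n) π t0 → Uiter n (π + t0) σ ≡ Uiter n t0 σ →
                     ∀ {t} → t0 ≤ t → Uiter n (π + t) σ ≡ Uiter n t σ
Uiter-period-shift n σ π t0 period t0≤t with m≤n⇒∃[o]m+o≡n t0≤t
... | j , refl = begin
  Uiter n (π + (t0 + j)) σ       ≡⟨ cong (λ s → Uiter n s σ) (shuffle π t0 j) ⟩
  Uiter n (j + (π + t0)) σ       ≡⟨ Uiter-+ n j (π + t0) σ ⟩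
  Uiter n j (Uiter n (π + t0) σ) ≡⟨ cong (Uiter n j) period ⟩
  Uiter n j (Uiter n t0 σ)       ≡⟨ Uiter-+ n j t0 σ ⟨
  Uiter n (j + t0) σ             ≡⟨ cong (λ s → Uiter n s σ) (+-comm j t0) ⟩
  Uiter n (t0 + j) σ             ∎
  where
  open ≡-Reasoning
  shuffle : ∀ π t0 j → π + (t0 + j) ≡ j + (π + t0)
  shuffle = solve-∀

Uiter-periodic : ∀ n (σ : Config n) π t0 → Uiter n (π + t0) σ ≡ Uiter n t0 σ →
                 ∀ k {t} → t0 ≤ t → Uiter n (k * π + t) σ ≡ Uiter n t σ
Uiter-periodic n σ π t0 period zero    t0≤t = refl
Uiter-periodic n σ π t0 period (suc k) {t} t0≤t = begin
  Uiter n (π + k * π + t) σ   ≡⟨ cong (λ s → Uiter n s σ) (+-assoc π (k * π) t) ⟩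
  Uiter n (π + (k * π + t)) σ ≡⟨ Uiter-period-shift n σ π t0 period t0≤kπ+t ⟩
  Uiter n (k * π + t) σ       ≡⟨ Uiter-periodic n σ π t0 period k t0≤t ⟩
  Uiter n t σ                 ∎
  where
  open ≡-Reasoning
  t0≤kπ+t : t0 ≤ k * π + t
  t0≤kπ+t = ≤-trans t0≤t (m≤n+m t (k * π))

-- Once u has fewer than n chips, u stays less than n chips ahead of v (Uiter-gap), and the
-- orbit from time s later passes through U^t σ again.
stall-closes-gap : ∀ n (σ : Config n) p t0 t → Uiter n (suc p + t0) σ ≡ Uiter n t0 σ → t0 ≤ t →
  ∀ u v s → lookup (Uiter n s σ) u < n → lookup (Uiter n t σ) u < lookup (Uiter n t σ) v + n
stall-closes-gap n σ p t0 t period t0≤t u v s stall =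
  subst (λ τ → lookup τ u < lookup τ v + n) returns
        (Uiter-gap n (s * p + t) (Uiter n s σ) u v (<-≤-trans stall (m≤n+m n _)))
  where
  open ≡-Reasoning
  shuffle : ∀ s p t → s * p + t + s ≡ s * suc p + t
  shuffle = solve-∀
  returns : Uiter n (s * p + t) (Uiter n s σ) ≡ Uiter n t σ
  returns = begin
    Uiter n (s * p + t) (Uiter n s σ) ≡⟨ Uiter-+ n (s * p + t) s σ ⟨
    Uiter n (s * p + t + s) σ         ≡⟨ cong (λ z → Uiter n z σ) (shuffle s p t) ⟩
    Uiter n (s * suc p + t) σ         ≡⟨ Uiter-periodic n σ (suc p) t0 period s t0≤t ⟩
    Uiter n t σ                       ∎

p≤∣p∣ : ∀ p → p ℚ.≤ ℚ.∣ p ∣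
p≤∣p∣ (mkℚ (+ _)    _ _) = ℚP.≤-refl
p≤∣p∣ (mkℚ -[1+ _ ] _ _) = ℚP.<⇒≤ (ℚP.neg<pos _ _)

p-q+q≡p : ∀ p q → p ℚ.- q ℚ.+ q ≡ p
p-q+q≡p p q =
  trans (ℚP.+-assoc p (ℚ.- q) q) (trans (cong (p ℚ.+_) (ℚP.+-inverseˡ q)) (ℚP.+-identityʳ p))

eventually-below : ∀ n .{{_ : NonZero n}} (σ : Config n) {a b} → HasActivity n σ a → a ℚ.< b →
                   ∃ λ N → ∀ k → N ≤ k → average n σ k ℚ.< b
eventually-below n σ {a} {b} act a<b
  with act (b ℚ.- a) (subst (ℚ._< b ℚ.- a) (ℚP.+-inverseʳ a) (ℚP.+-monoˡ-< (ℚ.- a) a<b))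
... | N , close = N , λ k N≤k → subst₂ ℚ._<_ (p-q+q≡p _ a) (p-q+q≡p b a)
  (ℚP.+-monoˡ-< a (ℚP.≤-<-trans (p≤∣p∣ _) (close k N≤k)))

cross⇒≤/ : ∀ b F M .{{_ : NonZero M}} → ↥ b ℤ.* + M ℤ.≤ + F ℤ.* ↧ b → b ℚ.≤ + F ℚ./ M
cross⇒≤/ b@record{} F (suc M) cross = ℚP.toℚᵘ-cancel-≤
  (ℚᵘP.≤-respʳ-≃ (ℚᵘP.≃-sym (ℚP.toℚᵘ-fromℚᵘ (ℚᵘ.mkℚᵘ (+ F) M))) (ℚᵘ.*≤* cross))

<1⇒↥<↧ : ∀ p → p ℚ.< 1ℚ → ↥ p ℤ.< ↧ p
<1⇒↥<↧ p (ℚ.*<* lt) = subst₂ ℤ._<_ (ℤP.*-identityʳ (↥ p)) (ℤP.*-identityˡ (↧ p)) lt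

-- p/q < 1 and F/M ≥ 1 − D/M ≥ 1 − 1/q give p/q ≤ F/M.
cross-≤-of-deficit : ∀ p q M F D → p < q → M ≤ F + D → D * q ≤ M → p * M ≤ F * q
cross-≤-of-deficit p q M F D p<q M≤F+D Dq≤M =
  subst (p * M ≤_) (*-comm q F) (+-cancelʳ-≤ M (p * M) (q * F) chain)
  where
  open ≤-Reasoning
  chain : p * M + M ≤ q * F + M
  chain = begin
    p * M + M      ≡⟨ +-comm (p * M) M ⟩
    suc p * M      ≤⟨ *-monoˡ-≤ M p<q ⟩
    q * M          ≤⟨ *-monoʳ-≤ q M≤F+D ⟩
    q * (F + D)    ≡⟨ *-distribˡ-+ q F D ⟩
    q * F + q * D  ≡⟨ cong (λ z → q * F + z) (*-comm q D) ⟩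
    q * F + D * q  ≤⟨ +-monoʳ-≤ (q * F) Dq≤M ⟩
    q * F + M      ∎

cross-≤-of-deficitℤ : ∀ (p : ℤ) q M F D → p ℤ.< + q → M ≤ F + D → D * q ≤ M →
                      p ℤ.* + M ℤ.≤ + F ℤ.* + q
cross-≤-of-deficitℤ (+ p) q M F D (+<+ p<q) M≤F+D Dq≤M =
  subst₂ ℤ._≤_ (ℤP.pos-* p M) (ℤP.pos-* F q) (+≤+ (cross-≤-of-deficit p q M F D p<q M≤F+D Dq≤M))
cross-≤-of-deficitℤ -[1+ p ] q M F D _ _ _ =
  ℤP.≤-trans (ℤP.*-monoʳ-≤-nonNeg (+ M) (-≤+ {p} {0})) (subst (+ 0 ℤ.≤_) (ℤP.pos-* F q) (+≤+ z≤n))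

average-eventually-≥ : ∀ n .{{_ : NonZero n}} (σ : Config n) T D →
  (∀ k → n * (k + T) ≤ firings n σ (k + T) + D) →
  ∀ {b} → b ℚ.< 1ℚ → ∀ N → ∃ λ k → N ≤ k × b ℚ.≤ average n σ k
average-eventually-≥ n σ T D linear {b} b<1 N = k , N≤k , b≤average
  where
  q k : ℕ
  q = ↧ₙ b
  k = N + D * q + T
  N≤k : N ≤ k
  N≤k = ≤-trans (m≤m+n N (D * q)) (m≤m+n (N + D * q) T)
  Dq≤nk : D * q ≤ n * suc k
  Dq≤nk = ≤-trans (≤-trans (m≤n+m (D * q) N) (≤-trans (m≤m+n (N + D * q) T) (n≤1+n k)))
                  (m≤n*m (suc k) n)
  b≤average : b ℚ.≤ average n σ k
  b≤average = cross⇒≤/ b (firings n σ (suc k)) (n * suc k) {{m*n≢0 n (suc k)}}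
    (cross-≤-of-deficitℤ (↥ b) q (n * suc k) (firings n σ (suc k)) D (<1⇒↥<↧ b b<1)
      (linear (suc (N + D * q))) Dq≤nk)

activity-≥1 : ∀ n .{{_ : NonZero n}} (σ : Config n) {a} T D → HasActivity n σ a →
              (∀ k → n * (k + T) ≤ firings n σ (k + T) + D) → ¬ a ℚ.< 1ℚ
activity-≥1 n σ T D act linear a<1 =
  let b , a<b , b<1     = ℚP.<-dense a<1
      N , below         = eventually-below n σ act a<b
      k , N≤k , b≤avg   = average-eventually-≥ n σ T D linear b<1 N
  in ℚP.<-irrefl refl (ℚP.<-≤-trans (below k N≤k) b≤avg)

no-eternal-firer : ∀ n .{{_ : NonZero n}} (σ : Config n) {a} → HasActivity n σ a → a ℚ.< 1ℚ →
                   ∀ u T → ¬ FiresFrom n σ u T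
no-eternal-firer n σ act a<1 u T fires =
  activity-≥1 n σ T _ act (firings-linear n σ u T fires) a<1

stationary-fires-forever : ∀ n (σ : Config n) t → (∀ w → n ≤ lookup (Uiter n t σ) w) →
                           ∀ v → FiresFrom n σ v t
stationary-fires-forever n σ t all v s t≤s with m≤n⇒∃[o]m+o≡n t≤s
... | j , refl = subst (λ τ → n ≤ lookup τ v) (sym stays) (all v)
  where
  stays : Uiter n (t + j) σ ≡ Uiter n t σ
  stays = begin
    Uiter n (t + j) σ         ≡⟨ cong (λ s → Uiter n s σ) (+-comm t j) ⟩
    Uiter n (j + t) σ         ≡⟨ Uiter-+ n j t σ ⟩
    Uiter n j (Uiter n t σ)   ≡⟨ Uiter-stationary n _ (U-stationary n _ all) j ⟩
    Uiter n t σ               ∎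
    where open ≡-Reasoning

high-forces-firing : ∀ m {x y} → 2 * suc m ∸ 1 < x → x ∸ y ≤ m → suc m ≤ y
high-forces-firing m {x} {y} high spread = ≮⇒≥ λ y<n → <⇒≱ high (begin
  x                   ≤⟨ m≤n+m∸n x y ⟩
  y + (x ∸ y)         ≤⟨ +-mono-≤ (s≤s⁻¹ y<n) spread ⟩
  m + m               ≤⟨ +-monoʳ-≤ m (≤-trans (n≤1+n m) (m≤m+n (suc m) 0)) ⟩
  2 * suc m ∸ 1       ∎)
  where open ≤-Reasoning

lemma4p2 : (n : ℕ) .{{_ : NonZero n}} (σ : Config n) →
    (∃ λ (a : ℚ) → HasActivity n σ a × a ℚ.< 1ℚ) →
    (t0 : ℕ) → IsTransientLength n σ t0 →
    ∀ (t : ℕ) → t0 ≤ t → Confined n (Uiter n t σ)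
lemma4p2 n@(suc m) σ (a , act , a<1) t0 (recurs , _) t t0≤t
  with recurrence-period n σ t0 recurs
... | p , period = below-2n , spread
  where
  τ : Config n
  τ = Uiter n t σ
  spread : ∀ u v → lookup τ u ∸ lookup τ v ≤ m
  spread u v with lookup τ u <? lookup τ v + n
  ... | yes close = s≤s⁻¹ (m<n+o⇒m∸n<o (lookup τ u) (lookup τ v) close)
  ... | no far = ⊥-elim (no-eternal-firer n σ act a<1 u 0 λ s _ →
    ≮⇒≥ λ stall → far (stall-closes-gap n σ p t0 t period t0≤t u v s stall))
  below-2n : ∀ v → lookup τ v ≤ 2 * n ∸ 1
  below-2n v with lookup τ v ≤? 2 * n ∸ 1
  ... | yes low = low
  ... | no high = ⊥-elim (no-eternal-firer n σ act a<1 v t (stationary-fires-forever n σ t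
    (λ w → high-forces-firing m (≰⇒> high) (spread v w)) v))
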